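{- Let $1 \le t_1 < t_2 < n$ be integers with $n \ge t_1 + t_2$, and let $G = G_n\langle t_1, t_2\rangle$. If $t_2 \ne 2t_1$, then $G$ has a hole of length $(t_1+t_2)/\gcd(t_1,t_2)$.
   Context: For integers $1 \le t_1 < \cdots < t_k < n$, the Toeplitz graph $G_n\langle t_1, \ldots, t_k\rangle$ is the simple graph with vertex set $\{1, \ldots, n\}$ in which distinct vertices $i,j$ are adjacent iff $|i-j| \in \{t_1, \ldots, t_k\}$. A hole is an induced (chordless) cycle of length at least $4$. -}

module Defs where

open import Data.Nat using (ℕ; suc; _+_; _≤_; _<_; _%_; NonZero)
open import Data.Nat.Base using (∣_-_∣)
open import Data.Fin using (Fin; toℕ)
open import Data.Product using (_×_; Σ)
open import Data.Sum using (_⊎_)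
open import Relation.Binary.PropositionalEquality using (_≡_; _≢_)
open import Relation.Nullary using (¬_)
open import Function.Bundles using (_⇔_)
open import Function.Definitions using (Injective)

ToeplitzAdj : ℕ → ℕ → ℕ → ℕ → Set
ToeplitzAdj t₁ t₂ i j = i ≢ j × (∣ i - j ∣ ≡ t₁ ⊎ ∣ i - j ∣ ≡ t₂)

IsVertex : ℕ → ℕ → Set
IsVertex n v = 1 ≤ v × v ≤ n

CycAdj : (k : ℕ) → .{{NonZero k}} → Fin k → Fin k → Set
CycAdj k a b = toℕ b ≡ (toℕ a + 1) % k ⊎ toℕ a ≡ (toℕ b + 1) % k

-- A hole of length k in G_n⟨t₁,t₂⟩: k ≥ 4 distinct vertices v₀,…,v_{k-1}
-- such that vᵢ, vⱼ are adjacent in G iff i, j are cyclically consecutive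
-- (i.e. an induced cycle of length k).
HasHole : (n t₁ t₂ k : ℕ) → Set
HasHole n t₁ t₂ k =
  4 ≤ k × Σ (Fin k → ℕ) λ v →
    ((a : Fin k) → IsVertex n (v a)) ×
    Injective _≡_ _≡_ v ×
    ((a b : Fin k) → ToeplitzAdj t₁ t₂ (v a) (v b) ⇔ CycAdj' k a b)
  where
    CycAdj' : (k : ℕ) → Fin k → Fin k → Set
    CycAdj' (suc k) a b = CycAdj (suc k) a b
    CycAdj' 0 () _

{-# OPTIONS --safe #-}
-- With N = t₁ + t₂, two vertices x, y ∈ {0, …, N − 1} are adjacent exactly when
-- y ≡ x ± t₁ (mod N): x + t₁ ≡ x − t₂ (mod N), and exactly one of the two lies in
-- the window.  So on this window G is the circulant graph of Z_N with
-- connection set {±t₁}, and the orbit 0, t₁, 2t₁, … of t₁ in Z_N is an induced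
-- cycle of length k = N / gcd(t₁, t₂) (shifted by one to lie in {1, …, N}).
-- Writing t₁ = a g and t₂ = b g with gcd(a, b) = 1, we have k = a + b with a < b,
-- so k ≥ 4 unless (a, b) = (1, 2), i.e. t₂ = 2 t₁.
module Submission where

open import Defs
open import Data.Nat using (ℕ; _+_; _*_; _≤_; _<_)
open import Data.Nat.GCD using (gcd)
open import Relation.Binary.PropositionalEquality using (_≡_; _≢_)

open import Data.Nat using (zero; suc; _∸_; _%_; _/_; NonZero; z≤n; s≤s; ∣_-_∣; _<?_; >-nonZero; ≢-nonZero)
open import Data.Nat.Properties
open import Data.Nat.DivMod
open import Data.Nat.Divisibility
open import Data.Nat.Coprimality as Coprimality using (Coprime; coprime-/gcd; coprime-+; coprime-divisor)
open import Data.Nat.GCD using (gcd[m,n]∣m; gcd[m,n]∣n; gcd[m,n]≢0)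
open import Data.Fin using (Fin; toℕ)
open import Data.Fin.Properties using (toℕ<n; toℕ-injective)
open import Data.Product using (_,_)
open import Data.Sum using (_⊎_; inj₁; inj₂)
open import Data.Sum.Function.Propositional using (_⊎-⇔_)
open import Function using (_∘_)
open import Function.Bundles using (_⇔_; mk⇔; Equivalence)
open import Function.Properties.Equivalence using () renaming (trans to ⇔-trans)
open import Relation.Nullary using (yes; no; contradiction)
open import Relation.Binary.PropositionalEquality
  using (refl; sym; trans; cong; cong₂; subst; subst₂; module ≡-Reasoning)

[m%d+n]%d≡[m+n]%d : ∀ m n d .{{_ : NonZero d}} → (m % d + n) % d ≡ (m + n) % d
[m%d+n]%d≡[m+n]%d m n d = begin
  (m % d + n) % d         ≡⟨ %-distribˡ-+ (m % d) n d ⟩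
  (m % d % d + n % d) % d ≡⟨ cong (λ r → (r + n % d) % d) (m%n%n≡m%n m d) ⟩
  (m % d + n % d) % d     ≡⟨ %-distribˡ-+ m n d ⟨
  (m + n) % d             ∎
  where open ≡-Reasoning

%-≡⇒∣∸ : ∀ m n d .{{_ : NonZero d}} → m % d ≡ n % d → d ∣ m ∸ n
%-≡⇒∣∸ m n d eq = divides (m / d ∸ n / d) (begin
  m ∸ n                                     ≡⟨ cong₂ _∸_ (m≡m%n+[m/n]*n m d) (m≡m%n+[m/n]*n n d) ⟩
  (m % d + m / d * d) ∸ (n % d + n / d * d) ≡⟨ cong (λ r → (m % d + m / d * d) ∸ (r + n / d * d)) eq ⟨
  (m % d + m / d * d) ∸ (m % d + n / d * d) ≡⟨ [m+n]∸[m+o]≡n∸o (m % d) (m / d * d) (n / d * d) ⟩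
  m / d * d ∸ n / d * d                     ≡⟨ *-distribʳ-∸ d (m / d) (n / d) ⟨
  (m / d ∸ n / d) * d                       ∎)
  where open ≡-Reasoning

∣∧<⇒≡0 : ∀ {m n} → m ∣ n → n < m → n ≡ 0
∣∧<⇒≡0 {n = zero}  _   _   = refl
∣∧<⇒≡0 {n = suc _} m∣n n<m = contradiction m∣n (>⇒∤ n<m)

∣m-n∣≡o⇒n≡m+o⊎m≡n+o : ∀ m n {o} → ∣ m - n ∣ ≡ o → n ≡ m + o ⊎ m ≡ n + o
∣m-n∣≡o⇒n≡m+o⊎m≡n+o m n refl with ≤-total m n
... | inj₁ m≤n rewrite m≤n⇒∣m-n∣≡n∸m m≤n = inj₁ (sym (m+[n∸m]≡n m≤n))
... | inj₂ n≤m rewrite m≤n⇒∣n-m∣≡n∸m n≤m = inj₂ (sym (m+[n∸m]≡n n≤m))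

4≤m+n : ∀ {m n} → 1 ≤ m → m < n → (m ≡ 1 → n ≢ 2) → 4 ≤ m + n
4≤m+n {1} {1}                 _ (s≤s ()) _
4≤m+n {1} {2}                 _ _ m≡1⇒n≢2 = contradiction refl (m≡1⇒n≢2 refl)
4≤m+n {1} {suc (suc (suc _))} _ _ _       = s≤s (s≤s (s≤s (s≤s z≤n)))
4≤m+n {suc (suc m)} {n}       _ m<n _     =
  +-mono-≤ {2} {suc (suc m)} {2} {n} (s≤s (s≤s z≤n)) (≤-trans (s≤s (s≤s z≤n)) (<⇒≤ m<n))

ToeplitzAdj-sym : ∀ {s t x y} → ToeplitzAdj s t x y → ToeplitzAdj s t y x
ToeplitzAdj-sym {s} {t} {x} {y} (x≢y , d) =
  x≢y ∘ sym , subst (λ e → e ≡ s ⊎ e ≡ t) (∣-∣-comm x y) d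

ToeplitzAdj-suc : ∀ {s t x y} → ToeplitzAdj s t (suc x) (suc y) ⇔ ToeplitzAdj s t x y
ToeplitzAdj-suc = mk⇔ (λ (x≢y , d) → x≢y ∘ cong suc , d) (λ (x≢y , d) → x≢y ∘ suc-injective , d)

ToeplitzAdj-+ˡ : ∀ {s t} x → 1 ≤ s → ToeplitzAdj s t x (x + s)
ToeplitzAdj-+ˡ {s} x 1≤s = <⇒≢ (m<m+n x 1≤s) , inj₁ (∣m-m+n∣≡n x s)

ToeplitzAdj-+ʳ : ∀ {s t} x → 1 ≤ t → ToeplitzAdj s t x (x + t)
ToeplitzAdj-+ʳ {t = t} x 1≤t = <⇒≢ (m<m+n x 1≤t) , inj₂ (∣m-m+n∣≡n x t)

module Rotation (t₁ t₂ : ℕ) (1≤t₁ : 1 ≤ t₁) (1≤t₂ : 1 ≤ t₂) where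

  N : ℕ
  N = t₁ + t₂

  instance
    N-nonZero : NonZero N
    N-nonZero = >-nonZero (≤-trans 1≤t₁ (m≤m+n t₁ t₂))

  rotate : ℕ → ℕ
  rotate x = (x + t₁) % N

  rotate-+t₁ : ∀ x → x + t₁ < N → rotate x ≡ x + t₁
  rotate-+t₁ x = m<n⇒m%n≡m

  rotate-+t₂ : ∀ x → x < N → rotate (x + t₂) ≡ x
  rotate-+t₂ x x<N = begin
    (x + t₂ + t₁) % N   ≡⟨ cong (_% N) (+-assoc x t₂ t₁) ⟩
    (x + (t₂ + t₁)) % N ≡⟨ cong (λ m → (x + m) % N) (+-comm t₂ t₁) ⟩
    (x + N) % N         ≡⟨ [m+n]%n≡m%n x N ⟩
    x % N               ≡⟨ m<n⇒m%n≡m x<N ⟩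
    x                   ∎
    where open ≡-Reasoning

  rotate-adjacent : ∀ x → x < N → ToeplitzAdj t₁ t₂ x (rotate x)
  rotate-adjacent x x<N with x <? t₂
  ... | yes x<t₂ =
    subst (ToeplitzAdj t₁ t₂ x) (sym (rotate-+t₁ x x+t₁<N)) (ToeplitzAdj-+ˡ x 1≤t₁)
    where
      x+t₁<N : x + t₁ < N
      x+t₁<N = subst (x + t₁ <_) (+-comm t₂ t₁) (+-monoˡ-< t₁ x<t₂)
  ... | no x≮t₂ =
    subst₂ (ToeplitzAdj t₁ t₂) x∸t₂+t₂≡x (sym rotate-x)
      (ToeplitzAdj-sym (ToeplitzAdj-+ʳ (x ∸ t₂) 1≤t₂))
    where
      x∸t₂+t₂≡x : x ∸ t₂ + t₂ ≡ x
      x∸t₂+t₂≡x = m∸n+n≡m (≮⇒≥ x≮t₂)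
      rotate-x : rotate x ≡ x ∸ t₂
      rotate-x = trans (cong rotate (sym x∸t₂+t₂≡x))
                       (rotate-+t₂ (x ∸ t₂) (≤-<-trans (m∸n≤m x t₂) x<N))

  adjacent⇒rotate : ∀ x y → x < N → y < N → ToeplitzAdj t₁ t₂ x y → y ≡ rotate x ⊎ x ≡ rotate y
  adjacent⇒rotate x y x<N y<N (_ , inj₁ d) with ∣m-n∣≡o⇒n≡m+o⊎m≡n+o x y d
  ... | inj₁ refl = inj₁ (sym (rotate-+t₁ x y<N))
  ... | inj₂ refl = inj₂ (sym (rotate-+t₁ y x<N))
  adjacent⇒rotate x y x<N y<N (_ , inj₂ d) with ∣m-n∣≡o⇒n≡m+o⊎m≡n+o x y d
  ... | inj₁ refl = inj₂ (sym (rotate-+t₂ x x<N))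
  ... | inj₂ refl = inj₁ (sym (rotate-+t₂ y y<N))

  adjacent⇔rotate : ∀ {x y} → x < N → y < N → ToeplitzAdj t₁ t₂ x y ⇔ (y ≡ rotate x ⊎ x ≡ rotate y)
  adjacent⇔rotate {x} {y} x<N y<N = mk⇔ (adjacent⇒rotate x y x<N y<N) rotate⇒adjacent
    where
      rotate⇒adjacent : y ≡ rotate x ⊎ x ≡ rotate y → ToeplitzAdj t₁ t₂ x y
      rotate⇒adjacent (inj₁ y≡) = subst (ToeplitzAdj t₁ t₂ x) (sym y≡) (rotate-adjacent x x<N)
      rotate⇒adjacent (inj₂ x≡) =
        ToeplitzAdj-sym (subst (ToeplitzAdj t₁ t₂ y) (sym x≡) (rotate-adjacent y y<N))

-- The hypothesis `order` says that k is the additive order of t₁ modulo t₁ + t₂.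
module Orbit (t₁ t₂ k : ℕ) (1≤t₁ : 1 ≤ t₁) (1≤t₂ : 1 ≤ t₂) .{{_ : NonZero k}}
             (order : ∀ d → t₁ + t₂ ∣ d * t₁ ⇔ k ∣ d) where

  open Rotation t₁ t₂ 1≤t₁ 1≤t₂

  orbit : ℕ → ℕ
  orbit i = i * t₁ % N

  orbit<N : ∀ i → orbit i < N
  orbit<N i = m%n<n (i * t₁) N

  orbit-suc : ∀ i → orbit (suc i) ≡ rotate (orbit i)
  orbit-suc i = trans (cong (_% N) (+-comm t₁ (i * t₁))) (sym ([m%d+n]%d≡[m+n]%d (i * t₁) t₁ N))

  orbit-% : ∀ i → orbit (i % k) ≡ orbit i
  orbit-% i = begin
    i % k * t₁ % N                    ≡⟨ %-remove-+ʳ (i % k * t₁) N∣wrap ⟨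
    (i % k * t₁ + i / k * k * t₁) % N ≡⟨ cong (_% N) (*-distribʳ-+ t₁ (i % k) (i / k * k)) ⟨
    (i % k + i / k * k) * t₁ % N      ≡⟨ cong (λ m → m * t₁ % N) (m≡m%n+[m/n]*n i k) ⟨
    i * t₁ % N                        ∎
    where
      open ≡-Reasoning
      N∣wrap : N ∣ i / k * k * t₁
      N∣wrap = Equivalence.from (order (i / k * k)) (n∣m*n (i / k))

  orbit-next : ∀ i → orbit ((i + 1) % k) ≡ rotate (orbit i)
  orbit-next i = trans (orbit-% (i + 1)) (trans (cong orbit (+-comm i 1)) (orbit-suc i))

  orbit-injective : ∀ {i j} → i < k → j < k → orbit i ≡ orbit j → i ≡ j
  orbit-injective {i} {j} i<k j<k eq =
    ≤-antisym (m∸n≡0⇒m≤n (gap i j i<k eq)) (m∸n≡0⇒m≤n (gap j i j<k (sym eq)))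
    where
      gap : ∀ i j → i < k → orbit i ≡ orbit j → i ∸ j ≡ 0
      gap i j i<k eq = ∣∧<⇒≡0 (Equivalence.to (order (i ∸ j)) N∣[i∸j]t₁) (≤-<-trans (m∸n≤m i j) i<k)
        where
          N∣[i∸j]t₁ : N ∣ (i ∸ j) * t₁
          N∣[i∸j]t₁ = subst (N ∣_) (sym (*-distribʳ-∸ t₁ i j)) (%-≡⇒∣∸ (i * t₁) (j * t₁) N eq)

  orbit≡rotate⇔ : ∀ {i j} → i < k → j < k → orbit j ≡ rotate (orbit i) ⇔ j ≡ (i + 1) % k
  orbit≡rotate⇔ {i} {j} i<k j<k = mk⇔
    (λ eq → orbit-injective j<k (m%n<n (i + 1) k) (trans eq (sym (orbit-next i))))
    (λ eq → trans (cong orbit eq) (orbit-next i))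

  orbit-adjacent⇔ : ∀ {i j} → i < k → j < k →
    ToeplitzAdj t₁ t₂ (orbit i) (orbit j) ⇔ (j ≡ (i + 1) % k ⊎ i ≡ (j + 1) % k)
  orbit-adjacent⇔ {i} {j} i<k j<k =
    ⇔-trans (adjacent⇔rotate (orbit<N i) (orbit<N j)) (orbit≡rotate⇔ i<k j<k ⊎-⇔ orbit≡rotate⇔ j<k i<k)

orbit-hole : ∀ n t₁ t₂ k → 1 ≤ t₁ → 1 ≤ t₂ → t₁ + t₂ ≤ n → 4 ≤ k →
  (∀ d → t₁ + t₂ ∣ d * t₁ ⇔ k ∣ d) → HasHole n t₁ t₂ k
orbit-hole n t₁ t₂ (suc k) 1≤t₁ 1≤t₂ N≤n 4≤k order =
  4≤k , vertex ,
  (λ a → s≤s z≤n , ≤-trans (orbit<N (toℕ a)) N≤n) ,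
  (λ eq → toℕ-injective (orbit-injective (toℕ<n _) (toℕ<n _) (suc-injective eq))) ,
  (λ a b → ⇔-trans ToeplitzAdj-suc (orbit-adjacent⇔ (toℕ<n a) (toℕ<n b)))
  where
    open Orbit t₁ t₂ (suc k) 1≤t₁ 1≤t₂ order
    vertex : Fin (suc k) → ℕ
    vertex a = suc (orbit (toℕ a))

module GcdQuotients (t₁ t₂ k : ℕ) (1≤t₁ : 1 ≤ t₁) (k*g≡t₁+t₂ : k * gcd t₁ t₂ ≡ t₁ + t₂) where

  g : ℕ
  g = gcd t₁ t₂

  instance
    g-nonZero : NonZero g
    g-nonZero = ≢-nonZero (gcd[m,n]≢0 t₁ t₂ (inj₁ (λ t₁≡0 → <⇒≢ 1≤t₁ (sym t₁≡0))))

  a b : ℕ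
  a = t₁ / g
  b = t₂ / g

  a*g≡t₁ : a * g ≡ t₁
  a*g≡t₁ = m/n*n≡m (gcd[m,n]∣m t₁ t₂)

  b*g≡t₂ : b * g ≡ t₂
  b*g≡t₂ = m/n*n≡m (gcd[m,n]∣n t₁ t₂)

  k≡a+b : k ≡ a + b
  k≡a+b = *-cancelʳ-≡ k (a + b) g (begin
    k * g         ≡⟨ k*g≡t₁+t₂ ⟩
    t₁ + t₂       ≡⟨ cong₂ _+_ a*g≡t₁ b*g≡t₂ ⟨
    a * g + b * g ≡⟨ *-distribʳ-+ g a b ⟨
    (a + b) * g   ∎)
    where open ≡-Reasoning

  coprime-k-a : Coprime k a
  coprime-k-a = subst (λ m → Coprime m a) (sym k≡a+b) (coprime-+ (Coprimality.sym (coprime-/gcd t₁ t₂)))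

  order : ∀ d → t₁ + t₂ ∣ d * t₁ ⇔ k ∣ d
  order d = mk⇔ to from
    where
      to : t₁ + t₂ ∣ d * t₁ → k ∣ d
      to N∣dt₁ = coprime-divisor coprime-k-a (subst (k ∣_) (*-comm d a) (*-cancelʳ-∣ g kg∣dag))
        where
          kg∣dag : k * g ∣ d * a * g
          kg∣dag = subst₂ _∣_ (sym k*g≡t₁+t₂)
                     (trans (cong (d *_) (sym a*g≡t₁)) (sym (*-assoc d a g))) N∣dt₁
      from : k ∣ d → t₁ + t₂ ∣ d * t₁
      from k∣d = subst (_∣ d * t₁) k*g≡t₁+t₂
                   (∣-trans (*-monoˡ-∣ g k∣d) (*-monoʳ-∣ d (gcd[m,n]∣m t₁ t₂)))

  4≤k : t₁ < t₂ → t₂ ≢ 2 * t₁ → 4 ≤ k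
  4≤k t₁<t₂ t₂≢2t₁ = subst (4 ≤_) (sym k≡a+b) (4≤m+n 1≤a a<b a≡1⇒b≢2)
    where
      1≤a : 1 ≤ a
      1≤a = n≢0⇒n>0 (λ a≡0 → <⇒≢ 1≤t₁ (trans (sym (cong (_* g) a≡0)) a*g≡t₁))
      a<b : a < b
      a<b = *-cancelʳ-< g a b (subst₂ _<_ (sym a*g≡t₁) (sym b*g≡t₂) t₁<t₂)
      a≡1⇒b≢2 : a ≡ 1 → b ≢ 2
      a≡1⇒b≢2 a≡1 b≡2 = t₂≢2t₁ (begin
        t₂          ≡⟨ b*g≡t₂ ⟨
        b * g       ≡⟨ cong (_* g) b≡2 ⟩
        2 * g       ≡⟨ cong (2 *_) (*-identityˡ g) ⟨
        2 * (1 * g) ≡⟨ cong (λ m → 2 * (m * g)) a≡1 ⟨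
        2 * (a * g) ≡⟨ cong (2 *_) a*g≡t₁ ⟩
        2 * t₁      ∎)
        where open ≡-Reasoning

-- The hypothesis t₂ < n is implied by t₁ + t₂ ≤ n.
lemma12 : (n t₁ t₂ : ℕ) → 1 ≤ t₁ → t₁ < t₂ → t₂ < n → t₁ + t₂ ≤ n →
    t₂ ≢ 2 * t₁ →
    (k : ℕ) → k * gcd t₁ t₂ ≡ t₁ + t₂ → HasHole n t₁ t₂ k
lemma12 n t₁ t₂ 1≤t₁ t₁<t₂ _ N≤n t₂≢2t₁ k k*g≡t₁+t₂ =
  orbit-hole n t₁ t₂ k 1≤t₁ (≤-trans 1≤t₁ (<⇒≤ t₁<t₂)) N≤n (4≤k t₁<t₂ t₂≢2t₁) order
  where open GcdQuotients t₁ t₂ k 1≤t₁ k*g≡t₁+t₂
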